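{- Let $\{T_n\}_{n\geq 1}$ be a sequence of rational triangles in $X(T)$ any two of which are weakly metric equivalent, and let $\{f_n\}_{n\ge 1}$ be a sequence of maps in $V$ such that $f_i(T_i)=T_{i+1}$ for all $i\geq 1$. Then for all integers $k\geq i\geq 1$, the composition $f_k\circ f_{k-1}\circ\cdots\circ f_i$ belongs to $V$; in particular $f_k\circ\cdots\circ f_1\in V$ for every $k\geq 1$.
   Context: A rational triangle is a triangle with rational side lengths and rational area. Two rational triangles are weakly metric equivalent if they have the same area and the same perimeter. Work in a rectangular coordinate system and let $X(T)$ be the set of triangles with vertices $V_1=(0,0)$, $V_2=(r,0)$, $V_3=(s,t)$ with $r\in\mathbb{Q}_{>0}$, $s\in\mathbb{Q}_{\geq 0}$, $t\in\mathbb{Q}_{>0}$. For $a\in\mathbb{Q}_{>0}$ and $b\in\mathbb{Q}$ let $f_{a,b}$ be the affine map $(x,y)\mapsto(\tfrac{1}{a}x+by,\ ay)$, with matrix $\begin{pmatrix}1/a & b\\ 0 & a\end{pmatrix}$; for a triangle $T$, $f(T)$ denotes the image triangle with vertices $f(V_1),f(V_2),f(V_3)$, and $f_i(T_i)=T_{i+1}$ means the image of $T_i$ under $f_i$ is the triangle $T_{i+1}$. The set $V$ consists of those maps $f_{a,b}$ ($a\in\mathbb{Q}_{>0}$, $b\in\mathbb{Q}$) for which there exists a rational triangle $T\in X(T)$ such that $f(T)$ is a rational triangle weakly metric equivalent to $T$. Compositions of maps of the form $f_{a,b}$ are again of this form. -}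

module Defs where

open import Data.Nat using (ℕ; zero; suc) renaming (_+_ to _+ℕ_)
open import Data.Rational
open import Data.Rational.Properties using (pos⇒nonZero)
open import Data.Product using (Σ; _×_; _,_; ∃)
open import Relation.Binary.PropositionalEquality using (_≡_)

Point : Set
Point = ℚ × ℚ

record Triangle : Set where
  constructor tri
  field
    V₁ V₂ V₃ : Point
open Triangle public

-- Elements of X(T): V₁ = (0,0), V₂ = (r,0), V₃ = (s,t), r > 0, s ≥ 0, t > 0.
record XT : Set where
  constructor xt
  field
    r s t : ℚ
    r>0 : 0ℚ < r
    s≥0 : 0ℚ ≤ s
    t>0 : 0ℚ < t
open XT public

toTriangle : XT → Triangle
toTriangle T = tri (0ℚ , 0ℚ) (r T , 0ℚ) (s T , t T)

dist² : Point → Point → ℚ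
dist² (x , y) (x' , y') = (x - x') * (x - x') + (y - y') * (y - y')

IsLength : ℚ → ℚ → Set
IsLength d q = (0ℚ ≤ q) × (q * q ≡ d)

area : Triangle → ℚ
area (tri (x₁ , y₁) (x₂ , y₂) (x₃ , y₃)) =
  ½ * ∣ (x₂ - x₁) * (y₃ - y₁) - (x₃ - x₁) * (y₂ - y₁) ∣

record SideLengths (T : Triangle) : Set where
  constructor sides
  field
    ℓ₁ ℓ₂ ℓ₃ : ℚ
    isℓ₁ : IsLength (dist² (V₂ T) (V₃ T)) ℓ₁
    isℓ₂ : IsLength (dist² (V₁ T) (V₃ T)) ℓ₂
    isℓ₃ : IsLength (dist² (V₁ T) (V₂ T)) ℓ₃
open SideLengths public

perimeter : {T : Triangle} → SideLengths T → ℚ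
perimeter L = ℓ₁ L + ℓ₂ L + ℓ₃ L

-- A rational triangle: nondegenerate, rational side lengths (rational area is
-- automatic for rational vertices).
RationalTriangle : Triangle → Set
RationalTriangle T = (0ℚ < area T) × SideLengths T

WeaklyMetricEquivalent : Triangle → Triangle → Set
WeaklyMetricEquivalent T T' =
  Σ (RationalTriangle T) λ RT → Σ (RationalTriangle T') λ RT' →
    (area T ≡ area T') × (perimeter (Data.Product.proj₂ RT) ≡ perimeter (Data.Product.proj₂ RT'))

f : (a : ℚ) → 0ℚ < a → ℚ → Point → Point
f a a>0 b (x , y) = (x * inv + b * y , a * y)
  where
    inv : ℚ
    inv = (1/ a) {{pos⇒nonZero a {{positive a>0}}}}

image : (Point → Point) → Triangle → Triangle
image g (tri p q u) = tri (g p) (g q) (g u)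

InV : (a : ℚ) → 0ℚ < a → ℚ → Set
InV a a>0 b = ∃ λ (T : XT) →
  WeaklyMetricEquivalent (toTriangle T) (image (f a a>0 b) (toTriangle T))

InVMap : (Point → Point) → Set
InVMap g = Σ ℚ λ a → Σ (0ℚ < a) λ a>0 → Σ ℚ λ b →
  InV a a>0 b × (∀ p → g p ≡ f a a>0 b p)

-- compFrom F i j = F (i + j) ∘ ⋯ ∘ F (i + 1) ∘ F i
compFrom : (ℕ → Point → Point) → ℕ → ℕ → Point → Point
compFrom F i zero = F i
compFrom F i (suc j) = λ p → F (i +ℕ suc j) (compFrom F i j p)

{-# OPTIONS --safe #-}
-- The maps f_{a,b} form a group-like family: f_{a₂,b₂} ∘ f_{a₁,b₁} = f_{a₁a₂, b₁/a₂ + b₂a₁},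
-- so every composite f_k ∘ ⋯ ∘ f_i is again some f_{A,B}, and it sends T_i to T_{k+1}.
-- Since all the T_n are pairwise weakly metric equivalent, T_i itself witnesses that
-- f_{A,B} lies in V.
module Submission where

open import Defs
open import Data.Nat using (ℕ; _≤_; _∸_; suc; zero; s≤s; z≤n) renaming (_+_ to _+ℕ_)
open import Data.Nat.Properties using (+-suc; +-identityʳ; m≤m+n; ≤-refl; ≤-trans)
open import Data.Rational using (ℚ; 0ℚ; 1ℚ; _<_; _*_; _+_; 1/_; positive)
open import Data.Rational.Properties
  using (pos⇒nonZero; *-inverseʳ; *-identityʳ; *-identityˡ; pos*pos⇒pos; positive⁻¹)
open import Data.Rational.Solver using (module +-*-Solver)
open import Data.Product using (Σ; _,_)
open import Relation.Binary.PropositionalEquality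

open +-*-Solver

-- Definitionally the reciprocal used inside f, as the NonZero instance is irrelevant.
recip : (a : ℚ) → 0ℚ < a → ℚ
recip a a>0 = (1/ a) {{pos⇒nonZero a {{positive a>0}}}}

recip-inverseʳ : (a : ℚ) (a>0 : 0ℚ < a) → a * recip a a>0 ≡ 1ℚ
recip-inverseʳ a a>0 = *-inverseʳ a {{pos⇒nonZero a {{positive a>0}}}}

pos*pos>0 : (a c : ℚ) → 0ℚ < a → 0ℚ < c → 0ℚ < a * c
pos*pos>0 a c a>0 c>0 =
  positive⁻¹ (a * c) {{pos*pos⇒pos a {{positive a>0}} c {{positive c>0}}}}

recip-* : (a c : ℚ) (a>0 : 0ℚ < a) (c>0 : 0ℚ < c) →
  recip (a * c) (pos*pos>0 a c a>0 c>0) ≡ recip a a>0 * recip c c>0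
recip-* a c a>0 c>0 = begin
  x                          ≡⟨ sym (*-identityʳ x) ⟩
  x * 1ℚ                     ≡⟨ cong (x *_) (sym ia*ic-inverse) ⟩
  x * ((a * ia) * (c * ic))  ≡⟨ solve 5 (λ x a ia c ic →
                                   x :* ((a :* ia) :* (c :* ic)) := ((a :* c) :* x) :* (ia :* ic))
                                   refl x a ia c ic ⟩
  ((a * c) * x) * (ia * ic)  ≡⟨ cong (_* (ia * ic)) (recip-inverseʳ (a * c) (pos*pos>0 a c a>0 c>0)) ⟩
  1ℚ * (ia * ic)             ≡⟨ *-identityˡ _ ⟩
  ia * ic                    ∎
  where
  open ≡-Reasoning
  x  = recip (a * c) (pos*pos>0 a c a>0 c>0)
  ia = recip a a>0
  ic = recip c c>0
  ia*ic-inverse : (a * ia) * (c * ic) ≡ 1ℚ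
  ia*ic-inverse = trans (cong₂ _*_ (recip-inverseʳ a a>0) (recip-inverseʳ c c>0)) (*-identityˡ 1ℚ)

f-∘-f : (a₁ : ℚ) (a₁>0 : 0ℚ < a₁) (b₁ a₂ : ℚ) (a₂>0 : 0ℚ < a₂) (b₂ : ℚ) (p : Point) →
  f a₂ a₂>0 b₂ (f a₁ a₁>0 b₁ p)
    ≡ f (a₁ * a₂) (pos*pos>0 a₁ a₂ a₁>0 a₂>0) (b₁ * recip a₂ a₂>0 + b₂ * a₁) p
f-∘-f a₁ a₁>0 b₁ a₂ a₂>0 b₂ (x , y) = cong₂ _,_ first second
  where
  i₁ = recip a₁ a₁>0
  i₂ = recip a₂ a₂>0
  first : (x * i₁ + b₁ * y) * i₂ + b₂ * (a₁ * y)
        ≡ x * recip (a₁ * a₂) (pos*pos>0 a₁ a₂ a₁>0 a₂>0) + (b₁ * i₂ + b₂ * a₁) * y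
  first = trans
    (solve 7 (λ x y i₁ i₂ b₁ b₂ a₁ →
       (x :* i₁ :+ b₁ :* y) :* i₂ :+ b₂ :* (a₁ :* y) := x :* (i₁ :* i₂) :+ (b₁ :* i₂ :+ b₂ :* a₁) :* y)
       refl x y i₁ i₂ b₁ b₂ a₁)
    (cong (λ z → x * z + (b₁ * i₂ + b₂ * a₁) * y) (sym (recip-* a₁ a₂ a₁>0 a₂>0)))
  second : a₂ * (a₁ * y) ≡ (a₁ * a₂) * y
  second = solve 3 (λ a₁ a₂ y → a₂ :* (a₁ :* y) := (a₁ :* a₂) :* y) refl a₁ a₂ y

IsShearScaling : (Point → Point) → Set
IsShearScaling g = Σ ℚ λ a → Σ (0ℚ < a) λ a>0 → Σ ℚ λ b → ∀ p → g p ≡ f a a>0 b p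

IsShearScaling-∘ : {g h : Point → Point} →
  IsShearScaling h → IsShearScaling g → IsShearScaling (λ p → h (g p))
IsShearScaling-∘ {g} {h} (a₂ , a₂>0 , b₂ , h≗f) (a₁ , a₁>0 , b₁ , g≗f) =
  a₁ * a₂ , pos*pos>0 a₁ a₂ a₁>0 a₂>0 , b₁ * recip a₂ a₂>0 + b₂ * a₁ ,
  λ p → begin
    h (g p)                             ≡⟨ h≗f (g p) ⟩
    f a₂ a₂>0 b₂ (g p)                  ≡⟨ cong (f a₂ a₂>0 b₂) (g≗f p) ⟩
    f a₂ a₂>0 b₂ (f a₁ a₁>0 b₁ p)       ≡⟨ f-∘-f a₁ a₁>0 b₁ a₂ a₂>0 b₂ p ⟩
    f (a₁ * a₂) (pos*pos>0 a₁ a₂ a₁>0 a₂>0) (b₁ * recip a₂ a₂>0 + b₂ * a₁) p ∎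
  where open ≡-Reasoning

compFrom-isShearScaling : (F : ℕ → Point → Point) → (∀ n → IsShearScaling (F n)) →
  ∀ i j → IsShearScaling (compFrom F i j)
compFrom-isShearScaling F F-shear i zero    = F-shear i
compFrom-isShearScaling F F-shear i (suc j) =
  IsShearScaling-∘ (F-shear (i +ℕ suc j)) (compFrom-isShearScaling F F-shear i j)

image-cong : {g h : Point → Point} → (∀ p → g p ≡ h p) → ∀ Δ → image g Δ ≡ image h Δ
image-cong g≗h (tri p q u) = cong₃ (g≗h p) (g≗h q) (g≗h u)
  where
  cong₃ : ∀ {p′ q′ u′ p″ q″ u″} → p′ ≡ p″ → q′ ≡ q″ → u′ ≡ u″ → tri p′ q′ u′ ≡ tri p″ q″ u″
  cong₃ refl refl refl = refl

image-compFrom : (F : ℕ → Point → Point) (Δ : ℕ → Triangle) (i : ℕ) →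
  (∀ n → i ≤ n → image (F n) (Δ n) ≡ Δ (suc n)) →
  ∀ j → image (compFrom F i j) (Δ i) ≡ Δ (suc (i +ℕ j))
image-compFrom F Δ i step zero =
  trans (step i ≤-refl) (cong (λ m → Δ (suc m)) (sym (+-identityʳ i)))
image-compFrom F Δ i step (suc j) = begin
  image (F n) (image (compFrom F i j) (Δ i))  ≡⟨ cong (image (F n)) (image-compFrom F Δ i step j) ⟩
  image (F n) (Δ (suc (i +ℕ j)))               ≡⟨ cong (λ m → image (F n) (Δ m)) (sym (+-suc i j)) ⟩
  image (F n) (Δ n)                           ≡⟨ step n (m≤m+n i (suc j)) ⟩
  Δ (suc n)                                   ∎
  where
  open ≡-Reasoning
  n = i +ℕ suc j

shearScaling-inV : {g : Point → Point} → IsShearScaling g → (T : XT) {Δ : Triangle} →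
  image g (toTriangle T) ≡ Δ → WeaklyMetricEquivalent (toTriangle T) Δ → InVMap g
shearScaling-inV (a , a>0 , b , g≗f) T g[T]≡Δ T≈Δ = a , a>0 , b , (T , T≈f[T]) , g≗f
  where
  T≈f[T] : WeaklyMetricEquivalent (toTriangle T) (image (f a a>0 b) (toTriangle T))
  T≈f[T] = subst (WeaklyMetricEquivalent (toTriangle T))
    (trans (sym g[T]≡Δ) (image-cong g≗f (toTriangle T))) T≈Δ

proposition2p8 :
    (T : ℕ → XT) (a : ℕ → ℚ) (a>0 : ∀ n → 0ℚ < a n) (b : ℕ → ℚ) →
    (∀ m n → 1 ≤ m → 1 ≤ n →
      WeaklyMetricEquivalent (toTriangle (T m)) (toTriangle (T n))) →
    (∀ n → 1 ≤ n → InV (a n) (a>0 n) (b n)) →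
    (∀ i → 1 ≤ i →
      image (f (a i) (a>0 i) (b i)) (toTriangle (T i)) ≡ toTriangle (T (suc i))) →
    ∀ i k → 1 ≤ i → i ≤ k →
      InVMap (compFrom (λ n → f (a n) (a>0 n) (b n)) i (k ∸ i))
proposition2p8 T a a>0 b equivalent _ maps-to i k 1≤i _ =
  shearScaling-inV (compFrom-isShearScaling F F-shear i (k ∸ i)) (T i)
    (image-compFrom F (λ n → toTriangle (T n)) i (λ n i≤n → maps-to n (≤-trans 1≤i i≤n)) (k ∸ i))
    (equivalent i (suc (i +ℕ (k ∸ i))) 1≤i (s≤s z≤n))
  where
  F : ℕ → Point → Point
  F n = f (a n) (a>0 n) (b n)
  F-shear : ∀ n → IsShearScaling (F n)
  F-shear n = a n , a>0 n , b n , λ _ → refl
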